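{- For all integers $m\ge1$ and $n\ge0$, $$\sum_{k=0}^n(-1)^{n-k}q^{m(n-k)}S_B^o[n,k]\equiv 1\pmod{q^m-q}$$ in the ring $\mathbb{Z}[q]$.
   Context: $[j]=1+q+\cdots+q^{j-1}$ and $[j]!!=[j][j-2][j-4]\cdots$ ending at $[1]$ or $[2]$, with $[0]!!=1$. Define $S_B[0,k]=\delta_{0,k}$ ($k\in\mathbb{Z}$), $S_B[n,k]=S_B[n-1,k-1]+[2k+1]S_B[n-1,k]$ for $n\ge1$, and $S_B^o[n,k]=[2k]!!\,S_B[n,k]$. -}

module Defs where

open import Data.Nat as ℕ using (ℕ; zero; suc)
open import Data.Integer as ℤ using (ℤ; +_; 0ℤ; 1ℤ)
open import Data.List using (List; []; _∷_)
open import Data.Product using (∃)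
open import Relation.Binary.PropositionalEquality using (_≡_)

-- Polynomials in ℤ[q] as coefficient lists, constant term first.
Poly : Set
Poly = List ℤ

coeff : Poly → ℕ → ℤ
coeff []       _       = 0ℤ
coeff (a ∷ _)  zero    = a
coeff (_ ∷ p)  (suc i) = coeff p i

-- equality in ℤ[q]: all coefficients agree (trailing zeros irrelevant)
infix 4 _≈ₚ_
_≈ₚ_ : Poly → Poly → Set
p ≈ₚ r = ∀ i → coeff p i ≡ coeff r i

infixl 6 _+ₚ_ _-ₚ_
infixl 7 _*ₚ_ _·ₚ_

_+ₚ_ : Poly → Poly → Poly
[]      +ₚ r       = r
(a ∷ p) +ₚ []      = a ∷ p
(a ∷ p) +ₚ (b ∷ r) = (a ℤ.+ b) ∷ (p +ₚ r)

_·ₚ_ : ℤ → Poly → Poly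
c ·ₚ []      = []
c ·ₚ (a ∷ p) = (c ℤ.* a) ∷ (c ·ₚ p)

negₚ : Poly → Poly
negₚ p = ℤ.-_ (+ 1) ·ₚ p

_-ₚ_ : Poly → Poly → Poly
p -ₚ r = p +ₚ negₚ r

shift : Poly → Poly
shift p = 0ℤ ∷ p

_*ₚ_ : Poly → Poly → Poly
[]      *ₚ r = []
(a ∷ p) *ₚ r = (a ·ₚ r) +ₚ shift (p *ₚ r)

constₚ : ℤ → Poly
constₚ c = c ∷ []

oneₚ : Poly
oneₚ = constₚ 1ℤ

qpow : ℕ → Poly
qpow zero    = oneₚ
qpow (suc j) = shift (qpow j)

_^ₚ_ : Poly → ℕ → Poly
p ^ₚ zero  = oneₚ
p ^ₚ suc j = p *ₚ (p ^ₚ j)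

qint : ℕ → Poly
qint zero    = []
qint (suc j) = oneₚ +ₚ shift (qint j)

qdfact : ℕ → Poly
qdfact zero          = oneₚ
qdfact (suc zero)    = qint 1
qdfact (suc (suc j)) = qint (suc (suc j)) *ₚ qdfact j

-- S_B[n,k] for k ∈ ℕ (for negative k it is 0, never needed below since
-- the recurrence with k = 0 uses S_B[n-1,-1] = 0).
SB : ℕ → ℕ → Poly
SB zero    zero    = oneₚ
SB zero    (suc k) = []
SB (suc n) zero    = qint 1 *ₚ SB n zero
SB (suc n) (suc k) = SB n k +ₚ (qint (2 ℕ.* suc k ℕ.+ 1) *ₚ SB n (suc k))

SBo : ℕ → ℕ → Poly
SBo n k = qdfact (2 ℕ.* k) *ₚ SB n k

sgn : ℕ → ℤ
sgn zero    = 1ℤ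
sgn (suc j) = ℤ.- sgn j

sumₚ : ℕ → (ℕ → Poly) → Poly
sumₚ zero    f = f 0
sumₚ (suc n) f = sumₚ n f +ₚ f (suc n)

infix 4 _∣ₚ_
_∣ₚ_ : Poly → Poly → Set
d ∣ₚ p = ∃ λ h → p ≈ₚ (d *ₚ h)

CongMod : Poly → Poly → Poly → Set
CongMod d a b = d ∣ₚ (a -ₚ b)

-- Since q^m ≡ q modulo q^m - q, every q^(m(n-k)) may be replaced by q^(n-k), so the sum is
-- congruent to Σ_k (-q)^(n-k) S_B^o[n,k], which equals 1 on the nose.  For that identity insert
-- the recurrence of S_B and [2k+2]!! = (1 + q[2k+1]) [2k]!!: the terms coming from [2k+1] S_B[n,k]
-- cancel those coming from the factor q [2k+1], and what remains is the sum for n - 1.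
module Submission where

open import Defs
open import Data.Nat as ℕ using (ℕ; zero; suc; _+_; _*_; _∸_; _≥_; _≤_; _<_; z≤n; s≤s)
import Data.Nat.Properties as ℕ
open import Data.Integer as ℤ using (0ℤ; 1ℤ)
import Data.Integer.Properties as ℤ
open import Data.List using ([]; _∷_)
open import Data.Maybe using (Maybe; just; nothing)
open import Data.Product using (_,_)
open import Function using (_∘_)
open import Level using (0ℓ)
open import Relation.Nullary using (yes)
open import Relation.Binary.Bundles using (Setoid)
import Relation.Binary.Reasoning.Setoid
open import Relation.Binary.PropositionalEquality using (_≡_; refl; sym; trans; cong; cong₂; subst; module ≡-Reasoning)
open import Algebra.Bundles using (CommutativeRing)
open import Tactic.RingSolver.Core.AlmostCommutativeRing using (AlmostCommutativeRing; fromCommutativeRing)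
open import Tactic.RingSolver using (solve-∀)

-- ℤ[q] as a commutative ring

-- A record around _≈ₚ_ so that the two polynomials can be inferred from a proof.
infix 4 _≋_
record _≋_ (p r : Poly) : Set where
  constructor ⟨_⟩
  field coeff-≡ : p ≈ₚ r
open _≋_ public

≋-refl : ∀ {p} → p ≋ p
≋-refl = ⟨ (λ _ → refl) ⟩

≋-sym : ∀ {p r} → p ≋ r → r ≋ p
≋-sym ⟨ e ⟩ = ⟨ (λ i → sym (e i)) ⟩

≋-trans : ∀ {p r s} → p ≋ r → r ≋ s → p ≋ s
≋-trans ⟨ e ⟩ ⟨ f ⟩ = ⟨ (λ i → trans (e i) (f i)) ⟩

≋-setoid : Setoid 0ℓ 0ℓ
≋-setoid = record { Carrier = Poly ; _≈_ = _≋_ ; isEquivalence = record { refl = ≋-refl ; sym = ≋-sym ; trans = ≋-trans } }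

module ≋-Reasoning = Relation.Binary.Reasoning.Setoid ≋-setoid

≡⇒≋ : ∀ {p r} → p ≡ r → p ≋ r
≡⇒≋ refl = ≋-refl

∷-cong : ∀ {a b p r} → a ≡ b → p ≋ r → a ∷ p ≋ b ∷ r
∷-cong a≡b ⟨ e ⟩ = ⟨ (λ { zero → a≡b ; (suc i) → e i }) ⟩

∷-≋[] : ∀ {a p} → a ≡ 0ℤ → p ≋ [] → a ∷ p ≋ []
∷-≋[] a≡0 ⟨ e ⟩ = ⟨ (λ { zero → a≡0 ; (suc i) → e i }) ⟩

≋[]-tail : ∀ {a p} → a ∷ p ≋ [] → p ≋ []
≋[]-tail ⟨ e ⟩ = ⟨ (λ i → e (suc i)) ⟩

∷-≋-tail : ∀ {a b p r} → a ∷ p ≋ b ∷ r → p ≋ r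
∷-≋-tail ⟨ e ⟩ = ⟨ (λ i → e (suc i)) ⟩

shift-cong : ∀ {p r} → p ≋ r → shift p ≋ shift r
shift-cong = ∷-cong refl

shift[]≋[] : shift [] ≋ []
shift[]≋[] = ∷-≋[] refl ≋-refl

+ₚ-identityʳ : ∀ p → p +ₚ [] ≡ p
+ₚ-identityʳ []      = refl
+ₚ-identityʳ (a ∷ p) = refl

+ₚ-comm : ∀ p r → p +ₚ r ≡ r +ₚ p
+ₚ-comm []      r       = sym (+ₚ-identityʳ r)
+ₚ-comm (a ∷ p) []      = refl
+ₚ-comm (a ∷ p) (b ∷ r) = cong₂ _∷_ (ℤ.+-comm a b) (+ₚ-comm p r)

+ₚ-assoc : ∀ p r s → (p +ₚ r) +ₚ s ≡ p +ₚ (r +ₚ s)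
+ₚ-assoc []      r       s       = refl
+ₚ-assoc (a ∷ p) []      s       = refl
+ₚ-assoc (a ∷ p) (b ∷ r) []      = refl
+ₚ-assoc (a ∷ p) (b ∷ r) (c ∷ s) = cong₂ _∷_ (ℤ.+-assoc a b c) (+ₚ-assoc p r s)

+ₚ-cong : ∀ {p p′ r r′} → p ≋ p′ → r ≋ r′ → p +ₚ r ≋ p′ +ₚ r′
+ₚ-cong {p} {p′} {r} {r′} ⟨ e ⟩ ⟨ f ⟩ =
  ⟨ (λ i → trans (coeff-+ₚ p r i) (trans (cong₂ ℤ._+_ (e i) (f i)) (sym (coeff-+ₚ p′ r′ i)))) ⟩
  where
  coeff-+ₚ : ∀ p r i → coeff (p +ₚ r) i ≡ coeff p i ℤ.+ coeff r i
  coeff-+ₚ []      r       i       = sym (ℤ.+-identityˡ _)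
  coeff-+ₚ (a ∷ p) []      i       = sym (ℤ.+-identityʳ _)
  coeff-+ₚ (a ∷ p) (b ∷ r) zero    = refl
  coeff-+ₚ (a ∷ p) (b ∷ r) (suc i) = coeff-+ₚ p r i

+ₚ-congˡ : ∀ p {r r′} → r ≋ r′ → p +ₚ r ≋ p +ₚ r′
+ₚ-congˡ p = +ₚ-cong (≋-refl {p})

·ₚ-cong : ∀ c {p r} → p ≋ r → c ·ₚ p ≋ c ·ₚ r
·ₚ-cong c {p} {r} ⟨ e ⟩ =
  ⟨ (λ i → trans (coeff-·ₚ p i) (trans (cong (c ℤ.*_) (e i)) (sym (coeff-·ₚ r i)))) ⟩
  where
  coeff-·ₚ : ∀ p i → coeff (c ·ₚ p) i ≡ c ℤ.* coeff p i
  coeff-·ₚ []      i       = sym (ℤ.*-zeroʳ c)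
  coeff-·ₚ (a ∷ p) zero    = refl
  coeff-·ₚ (a ∷ p) (suc i) = coeff-·ₚ p i

negₚ-inverseʳ : ∀ p → p +ₚ negₚ p ≋ []
negₚ-inverseʳ []      = ≋-refl
negₚ-inverseʳ (a ∷ p) = ∷-≋[] (trans (cong (λ x → a ℤ.+ x) (ℤ.-1*i≡-i a)) (ℤ.+-inverseʳ a)) (negₚ-inverseʳ p)

·ₚ-distribˡ : ∀ c p r → c ·ₚ (p +ₚ r) ≡ c ·ₚ p +ₚ c ·ₚ r
·ₚ-distribˡ c []      r       = refl
·ₚ-distribˡ c (a ∷ p) []      = refl
·ₚ-distribˡ c (a ∷ p) (b ∷ r) = cong₂ _∷_ (ℤ.*-distribˡ-+ c a b) (·ₚ-distribˡ c p r)

·ₚ-distribʳ : ∀ c d p → (c ℤ.+ d) ·ₚ p ≡ c ·ₚ p +ₚ d ·ₚ p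
·ₚ-distribʳ c d []      = refl
·ₚ-distribʳ c d (a ∷ p) = cong₂ _∷_ (ℤ.*-distribʳ-+ a c d) (·ₚ-distribʳ c d p)

·ₚ-assoc : ∀ c d p → c ·ₚ (d ·ₚ p) ≡ (c ℤ.* d) ·ₚ p
·ₚ-assoc c d []      = refl
·ₚ-assoc c d (a ∷ p) = cong₂ _∷_ (sym (ℤ.*-assoc c d a)) (·ₚ-assoc c d p)

·ₚ-identity : ∀ p → 1ℤ ·ₚ p ≡ p
·ₚ-identity []      = refl
·ₚ-identity (a ∷ p) = cong₂ _∷_ (ℤ.*-identityˡ a) (·ₚ-identity p)

0·ₚ≋[] : ∀ p → 0ℤ ·ₚ p ≋ []
0·ₚ≋[] []      = ≋-refl
0·ₚ≋[] (a ∷ p) = ∷-≋[] refl (0·ₚ≋[] p)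

·ₚ-shift : ∀ c p → c ·ₚ shift p ≋ shift (c ·ₚ p)
·ₚ-shift c p = ∷-cong (ℤ.*-zeroʳ c) ≋-refl

+ₚ-interchange : ∀ w x y z → (w +ₚ x) +ₚ (y +ₚ z) ≡ (w +ₚ y) +ₚ (x +ₚ z)
+ₚ-interchange w x y z = begin
  (w +ₚ x) +ₚ (y +ₚ z) ≡⟨ +ₚ-assoc w x (y +ₚ z) ⟩
  w +ₚ (x +ₚ (y +ₚ z)) ≡⟨ cong (w +ₚ_) (sym (+ₚ-assoc x y z)) ⟩
  w +ₚ ((x +ₚ y) +ₚ z) ≡⟨ cong (λ s → w +ₚ (s +ₚ z)) (+ₚ-comm x y) ⟩
  w +ₚ ((y +ₚ x) +ₚ z) ≡⟨ cong (w +ₚ_) (+ₚ-assoc y x z) ⟩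
  w +ₚ (y +ₚ (x +ₚ z)) ≡⟨ sym (+ₚ-assoc w y (x +ₚ z)) ⟩
  (w +ₚ y) +ₚ (x +ₚ z) ∎
  where open ≡-Reasoning

*ₚ-zeroˡ : ∀ {p} s → p ≋ [] → p *ₚ s ≋ []
*ₚ-zeroˡ {[]}    s p≋[] = ≋-refl
*ₚ-zeroˡ {a ∷ p} s p≋[] = ≋-trans
  (+ₚ-cong (≋-trans (≡⇒≋ (cong (_·ₚ s) (coeff-≡ p≋[] 0))) (0·ₚ≋[] s))
           (shift-cong (*ₚ-zeroˡ s (≋[]-tail p≋[]))))
  shift[]≋[]

*ₚ-zeroʳ : ∀ p → p *ₚ [] ≋ []
*ₚ-zeroʳ []      = ≋-refl
*ₚ-zeroʳ (a ∷ p) = ≋-trans (shift-cong (*ₚ-zeroʳ p)) shift[]≋[]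

*ₚ-congˡ : ∀ {p r} s → p ≋ r → p *ₚ s ≋ r *ₚ s
*ₚ-congˡ {[]}    {r}     s p≋r = ≋-sym (*ₚ-zeroˡ s (≋-sym p≋r))
*ₚ-congˡ {a ∷ p} {[]}    s p≋r = *ₚ-zeroˡ s p≋r
*ₚ-congˡ {a ∷ p} {b ∷ r} s p≋r =
  +ₚ-cong (≡⇒≋ (cong (_·ₚ s) (coeff-≡ p≋r 0))) (shift-cong (*ₚ-congˡ s (∷-≋-tail p≋r)))

*ₚ-congʳ : ∀ p {s s′} → s ≋ s′ → p *ₚ s ≋ p *ₚ s′
*ₚ-congʳ []      s≋s′ = ≋-refl
*ₚ-congʳ (a ∷ p) s≋s′ = +ₚ-cong (·ₚ-cong a s≋s′) (shift-cong (*ₚ-congʳ p s≋s′))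

*ₚ-cong : ∀ {p r s s′} → p ≋ r → s ≋ s′ → p *ₚ s ≋ r *ₚ s′
*ₚ-cong {r = r} {s} p≋r s≋s′ = ≋-trans (*ₚ-congˡ s p≋r) (*ₚ-congʳ r s≋s′)

*ₚ-distribʳ : ∀ s p r → (p +ₚ r) *ₚ s ≡ p *ₚ s +ₚ r *ₚ s
*ₚ-distribʳ s []      r       = refl
*ₚ-distribʳ s (a ∷ p) []      = sym (+ₚ-identityʳ _)
*ₚ-distribʳ s (a ∷ p) (b ∷ r) = trans
  (cong₂ (λ x y → x +ₚ shift y) (·ₚ-distribʳ a b s) (*ₚ-distribʳ s p r))
  (+ₚ-interchange (a ·ₚ s) (b ·ₚ s) (shift (p *ₚ s)) (shift (r *ₚ s)))

*ₚ-distribˡ : ∀ p r s → p *ₚ (r +ₚ s) ≡ p *ₚ r +ₚ p *ₚ s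
*ₚ-distribˡ []      r s = refl
*ₚ-distribˡ (a ∷ p) r s = trans
  (cong₂ (λ x y → x +ₚ shift y) (·ₚ-distribˡ a r s) (*ₚ-distribˡ p r s))
  (+ₚ-interchange (a ·ₚ r) (a ·ₚ s) (shift (p *ₚ r)) (shift (p *ₚ s)))

·ₚ-*ₚ : ∀ c p s → (c ·ₚ p) *ₚ s ≋ c ·ₚ (p *ₚ s)
·ₚ-*ₚ c []      s = ≋-refl
·ₚ-*ₚ c (a ∷ p) s = ≋-trans
  (+ₚ-cong (≡⇒≋ (sym (·ₚ-assoc c a s))) (≋-trans (shift-cong (·ₚ-*ₚ c p s)) (≋-sym (·ₚ-shift c (p *ₚ s)))))
  (≡⇒≋ (sym (·ₚ-distribˡ c (a ·ₚ s) (shift (p *ₚ s)))))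

shift-*ₚ : ∀ p s → shift p *ₚ s ≋ shift (p *ₚ s)
shift-*ₚ p s = +ₚ-cong (0·ₚ≋[] s) ≋-refl

*ₚ-assoc : ∀ p r s → (p *ₚ r) *ₚ s ≋ p *ₚ (r *ₚ s)
*ₚ-assoc []      r s = ≋-refl
*ₚ-assoc (a ∷ p) r s = ≋-trans (≡⇒≋ (*ₚ-distribʳ s (a ·ₚ r) (shift (p *ₚ r))))
  (+ₚ-cong (·ₚ-*ₚ a r s) (≋-trans (shift-*ₚ (p *ₚ r) s) (shift-cong (*ₚ-assoc p r s))))

*ₚ-∷ : ∀ p b r → p *ₚ (b ∷ r) ≋ b ·ₚ p +ₚ shift (p *ₚ r)
*ₚ-∷ []      b r = ≋-sym shift[]≋[]
*ₚ-∷ (a ∷ p) b r = ∷-cong (cong (ℤ._+ 0ℤ) (ℤ.*-comm a b)) (begin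
  a ·ₚ r +ₚ p *ₚ (b ∷ r)                ≈⟨ +ₚ-congˡ (a ·ₚ r) (*ₚ-∷ p b r) ⟩
  a ·ₚ r +ₚ (b ·ₚ p +ₚ shift (p *ₚ r))  ≡⟨ sym (+ₚ-assoc (a ·ₚ r) (b ·ₚ p) _) ⟩
  (a ·ₚ r +ₚ b ·ₚ p) +ₚ shift (p *ₚ r)  ≡⟨ cong (_+ₚ shift (p *ₚ r)) (+ₚ-comm (a ·ₚ r) (b ·ₚ p)) ⟩
  (b ·ₚ p +ₚ a ·ₚ r) +ₚ shift (p *ₚ r)  ≡⟨ +ₚ-assoc (b ·ₚ p) (a ·ₚ r) _ ⟩
  b ·ₚ p +ₚ (a ·ₚ r +ₚ shift (p *ₚ r))  ∎)
  where open ≋-Reasoning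

*ₚ-comm : ∀ p r → p *ₚ r ≋ r *ₚ p
*ₚ-comm []      r = ≋-sym (*ₚ-zeroʳ r)
*ₚ-comm (a ∷ p) r = ≋-trans (+ₚ-congˡ (a ·ₚ r) (shift-cong (*ₚ-comm p r))) (≋-sym (*ₚ-∷ r a p))

*ₚ-identityˡ : ∀ p → oneₚ *ₚ p ≋ p
*ₚ-identityˡ p = ≋-trans (+ₚ-congˡ (1ℤ ·ₚ p) shift[]≋[]) (≡⇒≋ (trans (+ₚ-identityʳ _) (·ₚ-identity p)))

*ₚ-identityʳ : ∀ p → p *ₚ oneₚ ≋ p
*ₚ-identityʳ p = ≋-trans (*ₚ-comm p oneₚ) (*ₚ-identityˡ p)

negₚ-cong : ∀ {p r} → p ≋ r → negₚ p ≋ negₚ r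
negₚ-cong = ·ₚ-cong _

·ₚ≋constₚ-*ₚ : ∀ c p → c ·ₚ p ≋ constₚ c *ₚ p
·ₚ≋constₚ-*ₚ c p = ≋-sym (≋-trans (+ₚ-congˡ (c ·ₚ p) shift[]≋[]) (≡⇒≋ (+ₚ-identityʳ (c ·ₚ p))))

ℤ[q] : CommutativeRing 0ℓ 0ℓ
ℤ[q] = record
  { Carrier = Poly ; _≈_ = _≋_ ; _+_ = _+ₚ_ ; _*_ = _*ₚ_ ; -_ = negₚ ; 0# = [] ; 1# = oneₚ
  ; isCommutativeRing = record
    { isRing = record
      { +-isAbelianGroup = record
        { isGroup = record
          { isMonoid = record
            { isSemigroup = record
              { isMagma = record { isEquivalence = Setoid.isEquivalence ≋-setoid ; ∙-cong = +ₚ-cong }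
              ; assoc = λ p r s → ≡⇒≋ (+ₚ-assoc p r s) }
            ; identity = (λ _ → ≋-refl) , (λ p → ≡⇒≋ (+ₚ-identityʳ p)) }
          ; inverse = (λ p → ≋-trans (≡⇒≋ (+ₚ-comm (negₚ p) p)) (negₚ-inverseʳ p)) , negₚ-inverseʳ
          ; ⁻¹-cong = negₚ-cong }
        ; comm = λ p r → ≡⇒≋ (+ₚ-comm p r) }
      ; *-cong = *ₚ-cong
      ; *-assoc = *ₚ-assoc
      ; *-identity = *ₚ-identityˡ , *ₚ-identityʳ
      ; distrib = (λ p r s → ≡⇒≋ (*ₚ-distribˡ p r s)) , (λ s p r → ≡⇒≋ (*ₚ-distribʳ s p r)) }
    ; *-comm = *ₚ-comm } }

-- The ring solver cancels a monomial only when it recognises its coefficient as zero,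
-- and that is decidable here.
ℤ[q]-almost : AlmostCommutativeRing 0ℓ 0ℓ
ℤ[q]-almost = fromCommutativeRing ℤ[q] []≟_
  where
  []≟_ : ∀ p → Maybe ([] ≋ p)
  []≟ []      = just ≋-refl
  []≟ (a ∷ p) with a ℤ.≟ 0ℤ | []≟ p
  ... | yes a≡0 | just []≋p = just (≋-sym (∷-≋[] a≡0 (≋-sym []≋p)))
  ... | _       | _         = nothing

sumₚ-cong : ∀ n {f g} → (∀ k → k ≤ n → f k ≋ g k) → sumₚ n f ≋ sumₚ n g
sumₚ-cong zero    f≋g = f≋g 0 z≤n
sumₚ-cong (suc n) f≋g = +ₚ-cong (sumₚ-cong n (λ k k≤n → f≋g k (ℕ.m≤n⇒m≤1+n k≤n))) (f≋g (suc n) ℕ.≤-refl)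

sumₚ-+ₚ : ∀ n f g → sumₚ n (λ k → f k +ₚ g k) ≡ sumₚ n f +ₚ sumₚ n g
sumₚ-+ₚ zero    f g = refl
sumₚ-+ₚ (suc n) f g = trans (cong (_+ₚ (f (suc n) +ₚ g (suc n))) (sumₚ-+ₚ n f g))
  (+ₚ-interchange (sumₚ n f) (sumₚ n g) (f (suc n)) (g (suc n)))

sumₚ-suc : ∀ n f → sumₚ (suc n) f ≡ f 0 +ₚ sumₚ n (f ∘ suc)
sumₚ-suc zero    f = refl
sumₚ-suc (suc n) f = trans (cong (_+ₚ f (suc (suc n))) (sumₚ-suc n f)) (+ₚ-assoc (f 0) (sumₚ n (f ∘ suc)) _)

-- Congruences modulo a polynomial

infix 4 _≡_mod_
record _≡_mod_ (a b d : Poly) : Set where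
  constructor congruent
  field
    quotient   : Poly
    difference : a -ₚ b ≋ d *ₚ quotient

≋⇒≡-mod : ∀ {a b} d → a ≋ b → a ≡ b mod d
≋⇒≡-mod {b = b} d a≋b = congruent [] (≋-trans (+ₚ-cong a≋b (≋-refl {negₚ b})) (≋-trans (negₚ-inverseʳ b) (≋-sym (*ₚ-zeroʳ d))))

≡-mod-refl : ∀ {a d} → a ≡ a mod d
≡-mod-refl {d = d} = ≋⇒≡-mod d ≋-refl

≡-mod⇒CongMod : ∀ {a b d} → a ≡ b mod d → CongMod d a b
≡-mod⇒CongMod (congruent h a-b≋dh) = h , coeff-≡ a-b≋dh

≡-mod-trans : ∀ {a b c d} → a ≡ b mod d → b ≡ c mod d → a ≡ c mod d
≡-mod-trans {a} {b} {c} {d} (congruent g a-b≋dg) (congruent h b-c≋dh) = congruent (g +ₚ h) (begin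
  a -ₚ c                  ≈⟨ split a b c ⟩
  (a -ₚ b) +ₚ (b -ₚ c)    ≈⟨ +ₚ-cong a-b≋dg b-c≋dh ⟩
  d *ₚ g +ₚ d *ₚ h        ≡⟨ sym (*ₚ-distribˡ d g h) ⟩
  d *ₚ (g +ₚ h)           ∎)
  where
  open ≋-Reasoning
  split : ∀ a b c → a -ₚ c ≋ (a -ₚ b) +ₚ (b -ₚ c)
  split = solve-∀ ℤ[q]-almost

≡-mod-+ₚ : ∀ {a b c e d} → a ≡ b mod d → c ≡ e mod d → a +ₚ c ≡ b +ₚ e mod d
≡-mod-+ₚ {a} {b} {c} {e} {d} (congruent g a-b≋dg) (congruent h c-e≋dh) = congruent (g +ₚ h) (begin
  (a +ₚ c) -ₚ (b +ₚ e)    ≈⟨ regroup a b c e ⟩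
  (a -ₚ b) +ₚ (c -ₚ e)    ≈⟨ +ₚ-cong a-b≋dg c-e≋dh ⟩
  d *ₚ g +ₚ d *ₚ h        ≡⟨ sym (*ₚ-distribˡ d g h) ⟩
  d *ₚ (g +ₚ h)           ∎)
  where
  open ≋-Reasoning
  regroup : ∀ a b c e → (a +ₚ c) -ₚ (b +ₚ e) ≋ (a -ₚ b) +ₚ (c -ₚ e)
  regroup = solve-∀ ℤ[q]-almost

≡-mod-*ₚ : ∀ {a b c e d} → a ≡ b mod d → c ≡ e mod d → a *ₚ c ≡ b *ₚ e mod d
≡-mod-*ₚ {a} {b} {c} {e} {d} (congruent g a-b≋dg) (congruent h c-e≋dh) = congruent (g *ₚ c +ₚ b *ₚ h) (begin
  a *ₚ c -ₚ b *ₚ e                      ≈⟨ split a b c e ⟩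
  (a -ₚ b) *ₚ c +ₚ b *ₚ (c -ₚ e)        ≈⟨ +ₚ-cong (*ₚ-congˡ c a-b≋dg) (*ₚ-congʳ b c-e≋dh) ⟩
  (d *ₚ g) *ₚ c +ₚ b *ₚ (d *ₚ h)        ≈⟨ regroup d g c b h ⟩
  d *ₚ (g *ₚ c +ₚ b *ₚ h)               ∎)
  where
  open ≋-Reasoning
  split : ∀ a b c e → a *ₚ c -ₚ b *ₚ e ≋ (a -ₚ b) *ₚ c +ₚ b *ₚ (c -ₚ e)
  split = solve-∀ ℤ[q]-almost
  regroup : ∀ d g c b h → (d *ₚ g) *ₚ c +ₚ b *ₚ (d *ₚ h) ≋ d *ₚ (g *ₚ c +ₚ b *ₚ h)
  regroup = solve-∀ ℤ[q]-almost

≡-mod-·ₚ : ∀ c {a b d} → a ≡ b mod d → c ·ₚ a ≡ c ·ₚ b mod d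
≡-mod-·ₚ c {a} {b} {d} a≡b =
  ≡-mod-trans (≋⇒≡-mod d (·ₚ≋constₚ-*ₚ c a))
  (≡-mod-trans (≡-mod-*ₚ (≡-mod-refl {constₚ c}) a≡b) (≋⇒≡-mod d (≋-sym (·ₚ≋constₚ-*ₚ c b))))

sumₚ-≡-mod : ∀ n {f g d} → (∀ k → f k ≡ g k mod d) → sumₚ n f ≡ sumₚ n g mod d
sumₚ-≡-mod zero    f≡g = f≡g 0
sumₚ-≡-mod (suc n) f≡g = ≡-mod-+ₚ (sumₚ-≡-mod n f≡g) (f≡g (suc n))

q : Poly
q = qpow 1

[-q]^_ : ℕ → Poly
[-q]^ j = sgn j ·ₚ qpow j

shift≋q*ₚ : ∀ p → shift p ≋ q *ₚ p
shift≋q*ₚ p = ≋-sym (≋-trans (shift-*ₚ oneₚ p) (shift-cong (*ₚ-identityˡ p)))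

qpow-+ : ∀ a b → qpow (a + b) ≋ qpow a *ₚ qpow b
qpow-+ zero    b = ≋-sym (*ₚ-identityˡ (qpow b))
qpow-+ (suc a) b = ≋-trans (shift-cong (qpow-+ a b)) (≋-sym (shift-*ₚ (qpow a) (qpow b)))

[-q]^-suc : ∀ j → [-q]^ suc j ≋ negₚ (q *ₚ [-q]^ j)
[-q]^-suc j = begin
  ℤ.- sgn j ·ₚ shift (qpow j)              ≡⟨ cong (_·ₚ shift (qpow j)) (sym (ℤ.-1*i≡-i (sgn j))) ⟩
  (ℤ.-1ℤ ℤ.* sgn j) ·ₚ shift (qpow j)      ≡⟨ sym (·ₚ-assoc _ (sgn j) (shift (qpow j))) ⟩
  negₚ (sgn j ·ₚ shift (qpow j))           ≈⟨ negₚ-cong (·ₚ-shift (sgn j) (qpow j)) ⟩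
  negₚ (shift ([-q]^ j))                   ≈⟨ negₚ-cong (shift≋q*ₚ ([-q]^ j)) ⟩
  negₚ (q *ₚ [-q]^ j)                      ∎
  where open ≋-Reasoning

qint-suc : ∀ j → qint (suc j) ≋ oneₚ +ₚ q *ₚ qint j
qint-suc j = +ₚ-congˡ oneₚ (shift≋q*ₚ (qint j))

qdfact-2suc : ∀ k → qdfact (2 * suc k) ≋ (oneₚ +ₚ q *ₚ qint (2 * k + 1)) *ₚ qdfact (2 * k)
qdfact-2suc k = begin
  qdfact (2 * suc k)
    ≡⟨ cong qdfact (ℕ.*-suc 2 k) ⟩
  qint (2 + 2 * k) *ₚ qdfact (2 * k)
    ≈⟨ *ₚ-congˡ (qdfact (2 * k)) (qint-suc (suc (2 * k))) ⟩
  (oneₚ +ₚ q *ₚ qint (suc (2 * k))) *ₚ qdfact (2 * k)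
    ≡⟨ cong (λ j → (oneₚ +ₚ q *ₚ qint j) *ₚ qdfact (2 * k)) (ℕ.+-comm 1 (2 * k)) ⟩
  (oneₚ +ₚ q *ₚ qint (2 * k + 1)) *ₚ qdfact (2 * k) ∎
  where open ≋-Reasoning

qpow-*-≡-mod : ∀ m j → qpow (m * j) ≡ qpow j mod qpow m -ₚ q
qpow-*-≡-mod m zero    rewrite ℕ.*-zeroʳ m = ≋⇒≡-mod (qpow m -ₚ q) ≋-refl
qpow-*-≡-mod m (suc j) rewrite ℕ.*-suc m j =
  ≡-mod-trans (≋⇒≡-mod (qpow m -ₚ q) (qpow-+ m (m * j)))
  (≡-mod-trans (≡-mod-*ₚ qpow-m≡q (qpow-*-≡-mod m j))
                (≋⇒≡-mod (qpow m -ₚ q) (≋-sym (shift≋q*ₚ (qpow j)))))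
  where
  qpow-m≡q : qpow m ≡ q mod qpow m -ₚ q
  qpow-m≡q = congruent oneₚ (≋-sym (*ₚ-identityʳ (qpow m -ₚ q)))

-- The identity Σ_k (-q)^(n-k) S_B^o[n,k] = 1

SB-vanishes-above-diagonal : ∀ {n k} → n < k → SB n k ≋ []
SB-vanishes-above-diagonal {zero}  {suc k} _         = ≋-refl
SB-vanishes-above-diagonal {suc n} {suc k} (s≤s n<k) = ≋-trans
  (+ₚ-cong (SB-vanishes-above-diagonal n<k)
           (*ₚ-congʳ (qint (2 * suc k + 1)) (SB-vanishes-above-diagonal (ℕ.m<n⇒m<1+n n<k))))
  (*ₚ-zeroʳ (qint (2 * suc k + 1)))

SBo-cancellation : ∀ n k → k ≤ n →
  [-q]^ (n ∸ k) *ₚ (qdfact (2 * suc k) *ₚ SB n k)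
    +ₚ [-q]^ (suc n ∸ k) *ₚ (qdfact (2 * k) *ₚ (qint (2 * k + 1) *ₚ SB n k))
  ≋ [-q]^ (n ∸ k) *ₚ SBo n k
SBo-cancellation n k k≤n = begin
  E *ₚ (qdfact (2 * suc k) *ₚ S) +ₚ [-q]^ (suc n ∸ k) *ₚ (D *ₚ (J *ₚ S))
    ≈⟨ +ₚ-cong (*ₚ-congʳ E (*ₚ-congˡ S (qdfact-2suc k))) (*ₚ-congˡ (D *ₚ (J *ₚ S)) sign-flip) ⟩
  E *ₚ (((oneₚ +ₚ q *ₚ J) *ₚ D) *ₚ S) +ₚ negₚ (q *ₚ E) *ₚ (D *ₚ (J *ₚ S))
    ≈⟨ ring-identity E D S q J ⟩
  E *ₚ (D *ₚ S) ∎
  where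
  open ≋-Reasoning
  E D J S : Poly
  E = [-q]^ (n ∸ k)
  D = qdfact (2 * k)
  J = qint (2 * k + 1)
  S = SB n k
  sign-flip : [-q]^ (suc n ∸ k) ≋ negₚ (q *ₚ E)
  sign-flip = subst (λ j → [-q]^ j ≋ negₚ (q *ₚ E)) (sym (ℕ.+-∸-assoc 1 k≤n)) ([-q]^-suc (n ∸ k))
  ring-identity : ∀ E D S Q J →
    E *ₚ (((oneₚ +ₚ Q *ₚ J) *ₚ D) *ₚ S) +ₚ negₚ (Q *ₚ E) *ₚ (D *ₚ (J *ₚ S)) ≋ E *ₚ (D *ₚ S)
  ring-identity = solve-∀ ℤ[q]-almost

alternating-SBo-sum : ∀ n → sumₚ n (λ k → [-q]^ (n ∸ k) *ₚ SBo n k) ≋ oneₚ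
alternating-SBo-sum zero    = ≋-trans (*ₚ-congˡ (SBo 0 0) (≡⇒≋ (·ₚ-identity oneₚ))) (*ₚ-identityˡ (SBo 0 0))
alternating-SBo-sum (suc n) = begin
  sumₚ (suc n) term
    ≡⟨ sumₚ-suc n term ⟩
  weighted 0 +ₚ sumₚ n (term ∘ suc)
    ≈⟨ +ₚ-congˡ (weighted 0) (sumₚ-cong n (λ k _ → SB-recurrence-split k)) ⟩
  weighted 0 +ₚ sumₚ n (λ k → raised k +ₚ weighted (suc k))
    ≡⟨ cong (weighted 0 +ₚ_) (sumₚ-+ₚ n raised (weighted ∘ suc)) ⟩
  weighted 0 +ₚ (sumₚ n raised +ₚ sumₚ n (weighted ∘ suc))
    ≈⟨ swap (weighted 0) (sumₚ n raised) (sumₚ n (weighted ∘ suc)) ⟩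
  sumₚ n raised +ₚ (weighted 0 +ₚ sumₚ n (weighted ∘ suc))
    ≡⟨ cong (sumₚ n raised +ₚ_) (sym (sumₚ-suc n weighted)) ⟩
  sumₚ n raised +ₚ (sumₚ n weighted +ₚ weighted (suc n))
    ≈⟨ +ₚ-congˡ (sumₚ n raised) (+ₚ-congˡ (sumₚ n weighted) weighted-vanishes) ⟩
  sumₚ n raised +ₚ (sumₚ n weighted +ₚ [])
    ≡⟨ cong (sumₚ n raised +ₚ_) (+ₚ-identityʳ (sumₚ n weighted)) ⟩
  sumₚ n raised +ₚ sumₚ n weighted
    ≡⟨ sym (sumₚ-+ₚ n raised weighted) ⟩
  sumₚ n (λ k → raised k +ₚ weighted k)
    ≈⟨ sumₚ-cong n (SBo-cancellation n) ⟩
  sumₚ n (λ k → [-q]^ (n ∸ k) *ₚ SBo n k)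
    ≈⟨ alternating-SBo-sum n ⟩
  oneₚ ∎
  where
  open ≋-Reasoning
  term : ℕ → Poly
  term k = [-q]^ (suc n ∸ k) *ₚ SBo (suc n) k
  raised : ℕ → Poly
  raised k = [-q]^ (n ∸ k) *ₚ (qdfact (2 * suc k) *ₚ SB n k)
  -- weighted 0 is term 0 on the nose, because S_B[n+1,0] = [1] S_B[n,0].
  weighted : ℕ → Poly
  weighted k = [-q]^ (suc n ∸ k) *ₚ (qdfact (2 * k) *ₚ (qint (2 * k + 1) *ₚ SB n k))
  SB-recurrence-split : ∀ k → term (suc k) ≋ raised k +ₚ weighted (suc k)
  SB-recurrence-split k = distrib ([-q]^ (n ∸ k)) (qdfact (2 * suc k)) (SB n k) (qint (2 * suc k + 1) *ₚ SB n (suc k))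
    where
    distrib : ∀ E D S X → E *ₚ (D *ₚ (S +ₚ X)) ≋ E *ₚ (D *ₚ S) +ₚ E *ₚ (D *ₚ X)
    distrib = solve-∀ ℤ[q]-almost
  swap : ∀ a b c → a +ₚ (b +ₚ c) ≋ b +ₚ (a +ₚ c)
  swap = solve-∀ ℤ[q]-almost
  weighted-vanishes : weighted (suc n) ≋ []
  weighted-vanishes = ≋-trans (*ₚ-congʳ E (*ₚ-congʳ D (≋-trans (*ₚ-congʳ J S≋[]) (*ₚ-zeroʳ J))))
                              (≋-trans (*ₚ-congʳ E (*ₚ-zeroʳ D)) (*ₚ-zeroʳ E))
    where
    E D J : Poly
    E = [-q]^ (suc n ∸ suc n)
    D = qdfact (2 * suc n)
    J = qint (2 * suc n + 1)
    S≋[] : SB n (suc n) ≋ []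
    S≋[] = SB-vanishes-above-diagonal (ℕ.n<1+n n)

theorem5p11 : (m n : ℕ) → m ≥ 1 →
    CongMod (qpow m -ₚ qpow 1)
            (sumₚ n (λ k → (sgn (n ∸ k) ·ₚ qpow (m * (n ∸ k))) *ₚ SBo n k))
            oneₚ
theorem5p11 m n _ = ≡-mod⇒CongMod (≡-mod-trans reduce-exponents (≋⇒≡-mod d (alternating-SBo-sum n)))
  where
  d : Poly
  d = qpow m -ₚ q
  reduce-exponents : sumₚ n (λ k → (sgn (n ∸ k) ·ₚ qpow (m * (n ∸ k))) *ₚ SBo n k)
                   ≡ sumₚ n (λ k → [-q]^ (n ∸ k) *ₚ SBo n k) mod d
  reduce-exponents = sumₚ-≡-mod n λ k →
    ≡-mod-*ₚ (≡-mod-·ₚ (sgn (n ∸ k)) (qpow-*-≡-mod m (n ∸ k))) ≡-mod-refl
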